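{- Let $\Gamma=(\mathcal{P},\mathcal{L},\mathtt{I})$ be a finite weak generalised $2m$-gon of order $(s,t)$, $m\ge2$, and $\mathbb{F}$ a field. For any two points $v,w$, $\mathfrak{c}_v-\mathfrak{c}_w\in\mathfrak{C}_{\mathbb{F}}^D$.
   Context: A weak generalised $n$-gon ($n\ge3$) is a point-line geometry (points, lines, symmetric incidence) with no ordinary $k$-gon as subgeometry for $2\le k<n$ and in which any two elements lie in a common ordinary $n$-gon; distance is in the bipartite incidence graph. Order $(s,t)$: each line has $s+1$ points, each point on $t+1$ lines. $\mathcal{P}_i(v)$ is the set of points at distance exactly $i$ from $v$. Integers are interpreted in $\mathbb{F}$ via $k\mapsto k\cdot1_{\mathbb{F}}$. $\mathbb{F}\mathcal{P}$ is the space of functions $\mathcal{P}\to\mathbb{F}$ with $\langle\mathfrak{f},\mathfrak{g}\rangle=\sum_{x}\mathfrak{f}(x)\mathfrak{g}(x)$; $\mathfrak{i}_S$ is the indicator of $S$, $\mathfrak{i}_L$ that of the point set of line $L$. $\mathfrak{C}_{\mathbb{F}}$ is the span of $\{\mathfrak{i}_L:L\in\mathcal{L}\}$ and $\mathfrak{C}_{\mathbb{F}}^D=\{\mathfrak{f}:\langle\mathfrak{f},\mathfrak{g}\rangle=0\ \forall\mathfrak{g}\in\mathfrak{C}_{\mathbb{F}}\}$. For a point $v$, $\mathfrak{c}_v=\sum_{k=0}^{m-1}\big(\sum_{j=0}^{m-k-1}(-s)^j\big)\mathfrak{i}_{\mathcal{P}_{2k}(v)}$. -}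

module Defs where

open import Level using (Level; _⊔_)
open import Data.Nat as ℕ using (ℕ; zero; suc)
open import Data.Nat.DivMod using (_%_; m%n<n)
open import Data.Bool using (Bool; true; false; _∨_; _∧_; not; if_then_else_)
open import Data.Fin using (Fin; zero; suc; toℕ; fromℕ<)
open import Data.Sum using (_⊎_; inj₁; inj₂)
open import Data.Product using (Σ; ∃; _×_; _,_)
open import Function using (_∘_)
open import Function.Definitions using (Injective)
open import Relation.Binary.PropositionalEquality using (_≡_)
open import Relation.Nullary using (¬_)
open import Relation.Nullary.Decidable using (⌊_⌋)
open import Data.Sum.Properties using (≡-dec)
import Data.Fin
open import Algebra.Bundles using (CommutativeRing)

record Field (c ℓ : Level) : Set (Level.suc (c ⊔ ℓ)) where
  field
    cring      : CommutativeRing c ℓ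
  open CommutativeRing cring public
  field
    1≉0        : ¬ (1# ≈ 0#)
    invertible : ∀ x → ¬ (x ≈ 0#) → Σ Carrier (λ y → x * y ≈ 1#)

record Geometry : Set where
  field
    np nl : ℕ
    I     : Fin np → Fin nl → Bool

count : ∀ {n} → (Fin n → Bool) → ℕ
count {zero}  f = 0
count {suc n} f = (if f zero then 1 else 0) ℕ.+ count (f ∘ suc)

anyFin : ∀ {n} → (Fin n → Bool) → Bool
anyFin {zero}  f = false
anyFin {suc n} f = f zero ∨ anyFin (f ∘ suc)

next : ∀ {k} → Fin k → Fin k
next {suc k} i = fromℕ< (m%n<n (suc (toℕ i)) (suc k))

module _ (Γ : Geometry) where
  open Geometry Γ

  Pt = Fin np
  Ln = Fin nl

  -- elements of the geometry = vertices of the bipartite incidence graph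
  Elt = Fin np ⊎ Fin nl

  HasOrder : ℕ → ℕ → Set
  HasOrder s t = (∀ L → count (λ p → I p L) ≡ suc s)
               × (∀ p → count (λ L → I p L) ≡ suc t)

  -- An ordinary k-gon as subgeometry: distinct points p 0..p (k-1), distinct
  -- lines l 0..l (k-1), such that (among these) p i I l j holds exactly when
  -- j = i or i = next j, i.e. the induced incidence graph is a 2k-cycle
  -- p0 - l0 - p1 - l1 - ... - p(k-1) - l(k-1) - p0.
  record OrdinaryGon (k : ℕ) : Set where
    field
      pts   : Fin k → Pt
      lns   : Fin k → Ln
      pts-inj : Injective _≡_ _≡_ pts
      lns-inj : Injective _≡_ _≡_ lns
      inc   : ∀ i j → (I (pts i) (lns j) ≡ true) →
                ((j ≡ i) ⊎ (i ≡ next j))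
      inc₁  : ∀ i → I (pts i) (lns i) ≡ true
      inc₂  : ∀ j → I (pts (next j)) (lns j) ≡ true

  _∈Gon_ : ∀ {k} → Elt → OrdinaryGon k → Set
  inj₁ x ∈Gon G = ∃ λ i → OrdinaryGon.pts G i ≡ x
  inj₂ L ∈Gon G = ∃ λ i → OrdinaryGon.lns G i ≡ L

  record WeakGenPolygon (n : ℕ) : Set where
    field
      no-small-gons : ∀ k → 2 ℕ.≤ k → k ℕ.< n → ¬ OrdinaryGon k
      common-gon    : ∀ (a b : Elt) → Σ (OrdinaryGon n) (λ G → (a ∈Gon G) × (b ∈Gon G))

  adj : Elt → Elt → Bool
  adj (inj₁ p) (inj₁ q) = false
  adj (inj₁ p) (inj₂ L) = I p L
  adj (inj₂ L) (inj₁ p) = I p L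
  adj (inj₂ L) (inj₂ M) = false

  anyElt : (Elt → Bool) → Bool
  anyElt f = anyFin (f ∘ inj₁) ∨ anyFin (f ∘ inj₂)

  within : ℕ → Elt → Elt → Bool
  within zero    a b = ⌊ ≡-dec Data.Fin._≟_ Data.Fin._≟_ a b ⌋
  within (suc k) a b = within k a b ∨ anyElt (λ z → adj a z ∧ within k z b)

  distEq : ℕ → Elt → Elt → Bool
  distEq zero    a b = within zero a b
  distEq (suc i) a b = within (suc i) a b ∧ not (within i a b)

  inPᵢ : ℕ → Pt → Pt → Bool
  inPᵢ i v x = distEq i (inj₁ v) (inj₁ x)

module Lin {c ℓ} (F : Field c ℓ) (Γ : Geometry) where
  open Field F using (Carrier; _≈_; _+_; _*_; -_; 0#; 1#)
  open Geometry Γ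

  ℕ→F : ℕ → Carrier
  ℕ→F zero    = 0#
  ℕ→F (suc k) = 1# + ℕ→F k

  pow : Carrier → ℕ → Carrier
  pow a zero    = 1#
  pow a (suc j) = a * pow a j

  ΣF : ∀ {n} → (Fin n → Carrier) → Carrier
  ΣF {zero}  f = 0#
  ΣF {suc n} f = f zero + ΣF (f ∘ suc)

  ΣN : ℕ → (ℕ → Carrier) → Carrier
  ΣN zero    f = 0#
  ΣN (suc n) f = ΣN n f + f n

  bool→F : Bool → Carrier
  bool→F true  = 1#
  bool→F false = 0#

  FP : Set c
  FP = Fin np → Carrier

  ⟨_,_⟩ : FP → FP → Carrier
  ⟨ f , g ⟩ = ΣF (λ x → f x * g x)

  𝔦L : Fin nl → FP
  𝔦L L x = bool→F (I x L)

  𝔦P : ℕ → Fin np → FP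
  𝔦P i v x = bool→F (inPᵢ Γ i v x)

  InC : FP → Set (c ⊔ ℓ)
  InC g = Σ (Fin nl → Carrier) (λ a → ∀ x → g x ≈ ΣF (λ L → a L * 𝔦L L x))

  InCD : FP → Set (c ⊔ ℓ)
  InCD f = ∀ g → InC g → ⟨ f , g ⟩ ≈ 0#

  𝔠 : (m s : ℕ) → Fin np → FP
  𝔠 m s v x = ΣN m (λ k → ΣN (m ℕ.∸ k) (λ j → pow (- ℕ→F s) j) * 𝔦P (2 ℕ.* k) v x)

-- Fix a point v and a line L.  In a weak generalised 2m-gon the distance from v to L is
-- odd and less than 2m, and L has a unique point x₀ nearest to v: two points of L at the
-- same distance 2r from v, together with geodesics back to v, would contain an ordinary
-- k-gon with 2 ≤ k < 2m.  So 𝔠_v takes the value a_r on x₀ and a_{r+1} on the s other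
-- points of L, where a_q = Σ_{j<m-q} (-s)^j is the coefficient of 𝔦_{𝒫_{2q}(v)}; since
-- a_r = 1 - s·a_{r+1}, this gives ⟨𝔠_v, 𝔦_L⟩ = a_r + s·a_{r+1} = 1.  Hence 𝔠_v - 𝔠_w is
-- orthogonal to every 𝔦_L, and so to their span ℭ_F.

module Submission where

open import Defs
open import Data.Bool using (Bool; true; false; _∨_; _∧_; not)
open import Data.Empty using (⊥; ⊥-elim)
open import Data.Fin as Fin using (Fin; toℕ)
open import Data.Fin.Properties using (punchInᵢ≢i; toℕ-fromℕ<; toℕ<n; toℕ-injective)
open import Data.Nat as ℕ using (ℕ; NonZero; zero; suc)
import Data.Nat.Properties as ℕ
open import Data.Product using (Σ; ∃; _×_; _,_; proj₁; proj₂)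
open import Data.Sum using (_⊎_; inj₁; inj₂; swap)
open import Function using (_∘_)
import Relation.Binary.PropositionalEquality as ≡
open ≡ using (_≡_; _≢_)
open import Relation.Nullary using (¬_; Dec; yes; no)

module LineSums {c ℓ} (F : Field c ℓ) (Γ : Geometry) where
  open Field F
  open Lin F Γ
  open Geometry Γ using (I; np; nl)
  open import Algebra.Properties.Ring ring using (-‿distribˡ-*; //-rightDividesˡ; x≈y⇒x∙y⁻¹≈ε; -1*x≈-x)
  open import Algebra.Properties.CommutativeSemigroup *-commutativeSemigroup using (x∙yz≈y∙xz)
  open import Algebra.Properties.Semiring.Sum semiring
    using (sum; sum-cong-≋; ∑-distrib-+; ∑-comm; *-distribˡ-sum; sum-replicate-zero; sum-remove)
  open import Relation.Binary.Reasoning.Setoid setoid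

  ΣF≡sum : ∀ {n} (f : Fin n → Carrier) → ΣF f ≡ sum f
  ΣF≡sum {zero}  f = ≡.refl
  ΣF≡sum {suc n} f = ≡.cong (f Fin.zero +_) (ΣF≡sum (f ∘ Fin.suc))

  ΣF-bool→F≈count : ∀ {n} (p : Fin n → Bool) → ΣF (bool→F ∘ p) ≈ ℕ→F (count p)
  ΣF-bool→F≈count {zero}  p = refl
  ΣF-bool→F≈count {suc n} p with p Fin.zero
  ... | true  = +-congˡ (ΣF-bool→F≈count (p ∘ Fin.suc))
  ... | false = trans (+-identityˡ _) (ΣF-bool→F≈count (p ∘ Fin.suc))

  sum-single : ∀ {n} (f : Fin n → Carrier) i → (∀ j → j ≢ i → f j ≈ 0#) → sum f ≈ f i
  sum-single {suc n} f i off = begin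
    sum f                         ≈⟨ sum-remove f ⟩
    f i + sum (f ∘ Fin.punchIn i) ≈⟨ +-congˡ (sum-cong-≋ (λ j → off _ (punchInᵢ≢i i j))) ⟩
    f i + sum {n} (λ _ → 0#)      ≈⟨ +-congˡ (sum-replicate-zero n) ⟩
    f i + 0#                      ≈⟨ +-identityʳ (f i) ⟩
    f i                           ∎

  ΣN-zero : ∀ n {h} → (∀ k → k ℕ.< n → h k ≈ 0#) → ΣN n h ≈ 0#
  ΣN-zero zero    _    = refl
  ΣN-zero (suc n) vanish = trans (+-cong (ΣN-zero n (λ k k<n → vanish k (ℕ.m<n⇒m<1+n k<n))) (vanish n ℕ.≤-refl))
                               (+-identityʳ 0#)

  ΣN-single : ∀ n {h q} → (∀ k → k ≢ q → h k ≈ 0#) → (n ℕ.≤ q → h q ≈ 0#) → ΣN n h ≈ h q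
  ΣN-single zero    off beyond = sym (beyond ℕ.z≤n)
  ΣN-single (suc n) {h} {q} off beyond with q ℕ.≟ n
  ... | yes ≡.refl = trans (+-congʳ (ΣN-zero n (λ k k<n → off k (ℕ.<⇒≢ k<n)))) (+-identityˡ (h q))
  ... | no  q≢n    = trans (+-cong (ΣN-single n off (λ n≤q → beyond (ℕ.≤∧≢⇒< n≤q (q≢n ∘ ≡.sym))))
                                   (off n (q≢n ∘ ≡.sym)))
                           (+-identityʳ (h q))

  ΣN-pow-suc : ∀ n x → ΣN (suc n) (pow x) ≈ 1# + x * ΣN n (pow x)
  ΣN-pow-suc zero x = begin
    0# + 1#       ≈⟨ +-identityˡ 1# ⟩
    1#            ≈⟨ +-identityʳ 1# ⟨
    1# + 0#       ≈⟨ +-congˡ (zeroʳ x) ⟨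
    1# + x * 0#   ∎
  ΣN-pow-suc (suc n) x = begin
    ΣN (suc n) (pow x) + x * pow x n         ≈⟨ +-congʳ (ΣN-pow-suc n x) ⟩
    (1# + x * ΣN n (pow x)) + x * pow x n    ≈⟨ +-assoc 1# _ _ ⟩
    1# + (x * ΣN n (pow x) + x * pow x n)    ≈⟨ +-congˡ (distribˡ x _ _) ⟨
    1# + x * (ΣN n (pow x) + pow x n)        ∎

  two-valued-line-sum : ∀ {L x₀ s a b} (f : FP) → I x₀ L ≡ true → count (λ x → I x L) ≡ suc s →
             f x₀ ≈ a → (∀ x → I x L ≡ true → x ≢ x₀ → f x ≈ b) → ⟨ f , 𝔦L L ⟩ ≈ a + ℕ→F s * b
  two-valued-line-sum {L} {x₀} {s} {a} {b} f x₀∈L line-size f-x₀ f-others = begin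
    ΣF (λ x → f x * 𝔦L L x)                ≡⟨ ΣF≡sum (λ x → f x * 𝔦L L x) ⟩
    sum (λ x → f x * 𝔦L L x)               ≈⟨ sum-cong-≋ (λ x → split (f x) (𝔦L L x)) ⟩
    sum (λ x → δ x + b * 𝔦L L x)           ≈⟨ ∑-distrib-+ δ (λ x → b * 𝔦L L x) ⟩
    sum δ + sum (λ x → b * 𝔦L L x)         ≈⟨ +-cong (sum-single δ x₀ δ-off) (sym (*-distribˡ-sum b (𝔦L L))) ⟩
    δ x₀ + b * sum (𝔦L L)                  ≈⟨ +-cong δ-x₀ (*-congˡ points-on-L) ⟩
    (a - b) + b * (1# + S)                 ≈⟨ +-congˡ (distribˡ b 1# S) ⟩
    (a - b) + (b * 1# + b * S)             ≈⟨ +-congˡ (+-cong (*-identityʳ b) (*-comm b S)) ⟩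
    (a - b) + (b + S * b)                  ≈⟨ +-assoc (a - b) b (S * b) ⟨
    ((a - b) + b) + S * b                  ≈⟨ +-congʳ (//-rightDividesˡ b a) ⟩
    a + S * b                              ∎
    where
    S : Carrier
    S = ℕ→F s
    δ : FP
    δ x = (f x - b) * 𝔦L L x
    split : ∀ y i → y * i ≈ (y - b) * i + b * i
    split y i = trans (*-congʳ (sym (//-rightDividesˡ b y))) (distribʳ i (y - b) b)
    δ-off : ∀ x → x ≢ x₀ → δ x ≈ 0#
    δ-off x x≢x₀ with I x L in x∈L
    ... | true  = trans (*-identityʳ _) (trans (+-congʳ (f-others x x∈L x≢x₀)) (-‿inverseʳ b))
    ... | false = zeroʳ _
    δ-x₀ : δ x₀ ≈ a - b
    δ-x₀ rewrite x₀∈L = trans (*-identityʳ _) (+-congʳ f-x₀)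
    points-on-L : sum (𝔦L L) ≈ 1# + S
    points-on-L = begin
      sum (𝔦L L)                  ≡⟨ ΣF≡sum (𝔦L L) ⟨
      ΣF (𝔦L L)                   ≈⟨ ΣF-bool→F≈count (λ x → I x L) ⟩
      ℕ→F (count (λ x → I x L))   ≡⟨ ≡.cong ℕ→F line-size ⟩
      1# + S                      ∎

  ⟨f-g,u⟩≈⟨f,u⟩-⟨g,u⟩ : ∀ (f g u : FP) → ⟨ (λ x → f x - g x) , u ⟩ ≈ ⟨ f , u ⟩ - ⟨ g , u ⟩
  ⟨f-g,u⟩≈⟨f,u⟩-⟨g,u⟩ f g u = begin
    ΣF (λ x → (f x - g x) * u x)                          ≡⟨ ΣF≡sum (λ x → (f x - g x) * u x) ⟩
    sum (λ x → (f x - g x) * u x)                         ≈⟨ sum-cong-≋ (λ x → distribʳ (u x) (f x) (- g x)) ⟩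
    sum (λ x → f x * u x + - g x * u x)                   ≈⟨ ∑-distrib-+ fu (λ x → - g x * u x) ⟩
    sum fu + sum (λ x → - g x * u x)                      ≈⟨ +-congˡ (sum-cong-≋ negate) ⟩
    sum fu + sum (λ x → - 1# * (g x * u x))               ≈⟨ +-congˡ (*-distribˡ-sum (- 1#) gu) ⟨
    sum fu + - 1# * sum gu                                ≈⟨ +-congˡ (-1*x≈-x (sum gu)) ⟩
    sum fu - sum gu                                       ≡⟨ ≡.cong₂ _-_ (≡.sym (ΣF≡sum fu)) (≡.sym (ΣF≡sum gu)) ⟩
    ⟨ f , u ⟩ - ⟨ g , u ⟩                                 ∎
    where
    fu gu : FP
    fu x = f x * u x
    gu x = g x * u x
    negate : ∀ x → - g x * u x ≈ - 1# * (g x * u x)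
    negate x = trans (sym (-‿distribˡ-* (g x) (u x))) (sym (-1*x≈-x (g x * u x)))

  orthogonal-to-lines⇒InCD : ∀ (h : FP) → (∀ L → ⟨ h , 𝔦L L ⟩ ≈ 0#) → InCD h
  orthogonal-to-lines⇒InCD h h⊥L g (α , g≈) = begin
    ΣF (λ x → h x * g x)                                ≡⟨ ΣF≡sum (λ x → h x * g x) ⟩
    sum (λ x → h x * g x)                               ≈⟨ sum-cong-≋ (λ x → *-congˡ (trans (g≈ x) (reflexive (ΣF≡sum (αi x))))) ⟩
    sum (λ x → h x * sum (αi x))                        ≈⟨ sum-cong-≋ (λ x → *-distribˡ-sum (h x) (αi x)) ⟩
    sum (λ x → sum (λ L → h x * (α L * 𝔦L L x)))        ≈⟨ sum-cong-≋ (λ x → sum-cong-≋ (λ L → x∙yz≈y∙xz (h x) (α L) (𝔦L L x))) ⟩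
    sum (λ x → sum (λ L → α L * (h x * 𝔦L L x)))        ≈⟨ ∑-comm (λ x L → α L * (h x * 𝔦L L x)) ⟩
    sum (λ L → sum (λ x → α L * (h x * 𝔦L L x)))        ≈⟨ sum-cong-≋ (λ L → *-distribˡ-sum (α L) (λ x → h x * 𝔦L L x)) ⟨
    sum (λ L → α L * sum (λ x → h x * 𝔦L L x))          ≈⟨ sum-cong-≋ (λ L → *-congˡ (trans (reflexive (≡.sym (ΣF≡sum (λ x → h x * 𝔦L L x)))) (h⊥L L))) ⟩
    sum (λ L → α L * 0#)                                ≈⟨ sum-cong-≋ (λ L → zeroʳ (α L)) ⟩
    sum {nl} (λ _ → 0#)                                 ≈⟨ sum-replicate-zero nl ⟩
    0#                                                  ∎
    where
    αi : Fin np → Fin nl → Carrier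
    αi x L = α L * 𝔦L L x

  equal-line-sums⇒InCD : ∀ (f g : FP) → (∀ L → ⟨ f , 𝔦L L ⟩ ≈ ⟨ g , 𝔦L L ⟩) → InCD (λ x → f x - g x)
  equal-line-sums⇒InCD f g equal = orthogonal-to-lines⇒InCD (λ x → f x - g x)
    (λ L → trans (⟨f-g,u⟩≈⟨f,u⟩-⟨g,u⟩ f g (𝔦L L)) (x≈y⇒x∙y⁻¹≈ε (equal L)))

  module _ (m s : ℕ) where

    -- The coefficient of 𝔦P (2 * q) in 𝔠 (0 for q ≥ m, by truncated subtraction).
    coeff : ℕ → Carrier
    coeff q = ΣN (m ℕ.∸ q) (pow (- ℕ→F s))

    coeff-telescopes : ∀ {q} → q ℕ.< m → coeff q + ℕ→F s * coeff (suc q) ≈ 1#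
    coeff-telescopes {q} q<m = begin
      coeff q + S * B                            ≡⟨ ≡.cong (λ n → ΣN n (pow (- S)) + S * B) (ℕ.+-∸-assoc 1 {m} {suc q} q<m) ⟩
      ΣN (suc (m ℕ.∸ suc q)) (pow (- S)) + S * B ≈⟨ +-congʳ (ΣN-pow-suc (m ℕ.∸ suc q) (- S)) ⟩
      (1# + - S * B) + S * B                     ≈⟨ +-assoc 1# (- S * B) (S * B) ⟩
      1# + (- S * B + S * B)                     ≈⟨ +-congˡ (+-congʳ (-‿distribˡ-* S B)) ⟨
      1# + (- (S * B) + S * B)                   ≈⟨ +-congˡ (-‿inverseˡ (S * B)) ⟩
      1# + 0#                                    ≈⟨ +-identityʳ 1# ⟩
      1#                                         ∎
      where
      S B : Carrier
      S = ℕ→F s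
      B = coeff (suc q)

    𝔠-value : ∀ {v x q} → inPᵢ Γ (2 ℕ.* q) v x ≡ true → (∀ k → inPᵢ Γ (2 ℕ.* k) v x ≡ true → k ≡ q) →
              𝔠 m s v x ≈ coeff q
    𝔠-value {v} {x} {q} x∈P₂q unique = begin
      𝔠 m s v x                     ≈⟨ ΣN-single m off beyond ⟩
      coeff q * 𝔦P (2 ℕ.* q) v x    ≡⟨ ≡.cong (λ b → coeff q * bool→F b) x∈P₂q ⟩
      coeff q * 1#                  ≈⟨ *-identityʳ (coeff q) ⟩
      coeff q                       ∎
      where
      off : ∀ k → k ≢ q → coeff k * bool→F (inPᵢ Γ (2 ℕ.* k) v x) ≈ 0#
      off k k≢q with inPᵢ Γ (2 ℕ.* k) v x in x∈P₂k
      ... | true  = ⊥-elim (k≢q (unique k x∈P₂k))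
      ... | false = zeroʳ (coeff k)
      beyond : m ℕ.≤ q → coeff q * 𝔦P (2 ℕ.* q) v x ≈ 0#
      beyond m≤q rewrite ℕ.m≤n⇒m∸n≡0 m≤q = zeroˡ _

-- ℕ arithmetic is opened only from here on: its _+_ and _*_ would clash with those of F above.
open import Data.Bool.Properties using (not-involutive; not-¬)
open import Data.Nat using (_+_; _*_; _∸_; _%_; _≤_; _<_; z≤n; s≤s; _≟_; _≤?_; _<?_)
open import Data.Nat.DivMod using (_mod_; m<n⇒m%n≡m; n%n≡0; m%n%n≡m%n; %-distribˡ-+; [m+n]%n≡m%n)
open import Data.Nat.Induction using (<-rec)
open import Data.Nat.Properties
open import Data.Sum.Properties using (≡-dec; inj₁-injective)
open import Relation.Binary.Definitions using (tri<; tri≈; tri>)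
open import Relation.Binary.PropositionalEquality
open import Relation.Nullary.Decidable using (⌊_⌋)

∨⁻ : ∀ {a b} → a ∨ b ≡ true → a ≡ true ⊎ b ≡ true
∨⁻ {true}  _ = inj₁ refl
∨⁻ {false} h = inj₂ h

∨⁺ˡ : ∀ {a} b → a ≡ true → a ∨ b ≡ true
∨⁺ˡ b refl = refl

∨⁺ʳ : ∀ a {b} → b ≡ true → a ∨ b ≡ true
∨⁺ʳ true  _ = refl
∨⁺ʳ false h = h

∧⁻ : ∀ {a b} → a ∧ b ≡ true → a ≡ true × b ≡ true
∧⁻ {true}  {true}  _ = refl , refl
∧⁻ {true}  {false} ()
∧⁻ {false}         ()

∧⁺ : ∀ {a b} → a ≡ true → b ≡ true → a ∧ b ≡ true
∧⁺ refl refl = refl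

not-true : ∀ {a} → not a ≡ true → a ≡ true → ⊥
not-true {true}  () _
not-true {false} _ ()

anyFin⁻ : ∀ {n} (f : Fin n → Bool) → anyFin f ≡ true → ∃ λ i → f i ≡ true
anyFin⁻ {suc n} f h with ∨⁻ {f Fin.zero} h
... | inj₁ f0 = Fin.zero , f0
... | inj₂ rest with anyFin⁻ (f ∘ Fin.suc) rest
...   | i , fi = Fin.suc i , fi

anyFin⁺ : ∀ {n} (f : Fin n → Bool) i → f i ≡ true → anyFin f ≡ true
anyFin⁺ f Fin.zero    h = ∨⁺ˡ _ h
anyFin⁺ f (Fin.suc i) h = ∨⁺ʳ (f Fin.zero) (anyFin⁺ (f ∘ Fin.suc) i h)

alternate : ℕ → Bool → Bool
alternate zero    b = b
alternate (suc n) b = not (alternate n b)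

alternate-even : ∀ i b → alternate (i + i) b ≡ b
alternate-even zero    b = refl
alternate-even (suc i) b rewrite +-suc i i =
  trans (not-involutive (alternate (i + i) b)) (alternate-even i b)

alternate≡⇒even : ∀ d b → alternate d b ≡ b → ∃ λ r → d ≡ r + r
alternate≡⇒even zero          b _  = 0 , refl
alternate≡⇒even (suc zero)    b eq = ⊥-elim (not-¬ refl (sym eq))
alternate≡⇒even (suc (suc d)) b eq with alternate≡⇒even d b (trans (sym (not-involutive _)) eq)
... | r , refl = suc r , cong suc (sym (+-suc r r))

cyclicSuc : ℕ → ℕ → ℕ
cyclicSuc K j with suc j <? K
... | yes _ = suc j
... | no  _ = 0

cyclicSuc-< : ∀ {K j} → suc j < K → cyclicSuc K j ≡ suc j
cyclicSuc-< {K} {j} j+1<K with suc j <? K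
... | yes _     = refl
... | no  j+1≮K = ⊥-elim (j+1≮K j+1<K)

cyclicSuc-wrap : ∀ {K j} → suc j ≡ K → cyclicSuc K j ≡ 0
cyclicSuc-wrap {K} {j} j+1≡K with suc j <? K
... | yes j+1<K = ⊥-elim (<-irrefl j+1≡K j+1<K)
... | no  _     = refl

cyclicSuc-bounded : ∀ {K j} → j < K → cyclicSuc K j < K
cyclicSuc-bounded {K} {j} j<K with suc j <? K
... | yes j+1<K = j+1<K
... | no  _     = ≤-<-trans z≤n j<K

cyclicSuc-injective : ∀ {K i j} → i < K → j < K → cyclicSuc K i ≡ cyclicSuc K j → i ≡ j
cyclicSuc-injective {K} {i} {j} i<K j<K eq with suc i <? K | suc j <? K
... | yes _     | yes _     = suc-injective eq
... | no  i+1≮K | no  j+1≮K = suc-injective (trans (≤-antisym i<K (≮⇒≥ i+1≮K)) (sym (≤-antisym j<K (≮⇒≥ j+1≮K))))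
... | yes _     | no  _     with () ← eq
... | no  _     | yes _     with () ← eq

2*n≡n+n : ∀ n → 2 * n ≡ n + n
2*n≡n+n n = cong (n +_) (+-identityʳ n)

double-injective : ∀ {i j} → i + i ≡ j + j → i ≡ j
double-injective {i} {j} eq with <-cmp i j
... | tri< i<j _ _ = ⊥-elim (<-irrefl eq (+-mono-< i<j i<j))
... | tri≈ _ i≡j _ = i≡j
... | tri> _ _ i>j = ⊥-elim (<-irrefl (sym eq) (+-mono-< i>j i>j))

double-suc : ∀ i → suc i + suc i ≡ suc (suc (i + i))
double-suc i = cong suc (+-suc i i)

double-< : ∀ {i k} → i < k → i + i < k + k
double-< i<k = +-mono-< i<k i<k

double-<-odd : ∀ {i k} → i < k → suc (i + i) < k + k
double-<-odd {i} {k} i<k = subst (_≤ k + k) (double-suc i) (+-mono-≤ i<k i<k)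

cyclicSuc-odd : ∀ {K j} → j < K → cyclicSuc (K + K) (suc (j + j)) ≡ cyclicSuc K j + cyclicSuc K j
cyclicSuc-odd {K} {j} j<K with suc j <? K
... | yes j+1<K = trans (cyclicSuc-< (subst (_< K + K) (double-suc j) (double-< j+1<K))) (sym (double-suc j))
... | no  j+1≮K = cyclicSuc-wrap (trans (sym (double-suc j)) (cong (λ n → n + n) (≤-antisym j<K (≮⇒≥ j+1≮K))))

cyclicSuc-∸ : ∀ {K b} → 0 < b → b < K → cyclicSuc K (K ∸ suc b) ≡ K ∸ b
cyclicSuc-∸ {K} {b} 0<b b<K = trans (cyclicSuc-< (subst (_< K) (+-∸-assoc 1 b<K) (∸-monoʳ-< 0<b (<⇒≤ b<K))))
                                    (sym (+-∸-assoc 1 b<K))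

cyclicSuc-last : ∀ {K} → 0 < K → cyclicSuc K (K ∸ 1) ≡ 0
cyclicSuc-last {suc K} _ = cyclicSuc-wrap refl

toℕ-next : ∀ {K} (j : Fin K) → toℕ (next j) ≡ cyclicSuc K (toℕ j)
toℕ-next {suc k} j with suc (toℕ j) <? suc k
... | yes j+1<K = trans (toℕ-fromℕ< _) (m<n⇒m%n≡m j+1<K)
... | no  j+1≮K = trans (toℕ-fromℕ< _)
                        (trans (cong (_% suc k) (≤-antisym (toℕ<n j) (≮⇒≥ j+1≮K))) (n%n≡0 (suc k)))

cyclicSuc-odd-next : ∀ {K} (j : Fin K) → cyclicSuc (K + K) (suc (toℕ j + toℕ j)) ≡ toℕ (next j) + toℕ (next j)
cyclicSuc-odd-next j = trans (cyclicSuc-odd (toℕ<n j)) (cong (λ n → n + n) (sym (toℕ-next j)))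

suc[m%n]%n≡suc[m]%n : ∀ m n .{{_ : NonZero n}} → suc (m % n) % n ≡ suc m % n
suc[m%n]%n≡suc[m]%n m n = begin
  (1 + m % n) % n             ≡⟨ %-distribˡ-+ 1 (m % n) n ⟩
  (1 % n + m % n % n) % n     ≡⟨ cong (λ r → (1 % n + r) % n) (m%n%n≡m%n m n) ⟩
  (1 % n + m % n) % n         ≡⟨ %-distribˡ-+ 1 m n ⟨
  (1 + m) % n                 ∎
  where open ≡-Reasoning

module Distance (Γ : Geometry) where

  -- The Boolean relations of Defs, wrapped in records so that their arguments are inferable.

  record Adj (a b : Elt Γ) : Set where
    constructor adjacent
    field adj≡true : adj Γ a b ≡ true
  open Adj public

  record Within (k : ℕ) (a b : Elt Γ) : Set where
    constructor mkWithin
    field within≡true : within Γ k a b ≡ true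
  open Within public

  record Dist (a b : Elt Γ) (d : ℕ) : Set where
    constructor mkDist
    field distEq≡true : distEq Γ d a b ≡ true
  open Dist public

  isPoint : Elt Γ → Bool
  isPoint (inj₁ _) = true
  isPoint (inj₂ _) = false

  Adj-sym : ∀ {a b} → Adj a b → Adj b a
  Adj-sym {inj₁ _} {inj₂ _} (adjacent h) = adjacent h
  Adj-sym {inj₂ _} {inj₁ _} (adjacent h) = adjacent h
  Adj-sym {inj₁ _} {inj₁ _} (adjacent ())
  Adj-sym {inj₂ _} {inj₂ _} (adjacent ())

  Adj-isPoint : ∀ {a b} → Adj a b → isPoint b ≡ not (isPoint a)
  Adj-isPoint {inj₁ _} {inj₂ _} _ = refl
  Adj-isPoint {inj₂ _} {inj₁ _} _ = refl
  Adj-isPoint {inj₁ _} {inj₁ _} (adjacent ())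
  Adj-isPoint {inj₂ _} {inj₂ _} (adjacent ())

  anyElt⁻ : (f : Elt Γ → Bool) → anyElt Γ f ≡ true → ∃ λ z → f z ≡ true
  anyElt⁻ f h with ∨⁻ {anyFin (f ∘ inj₁)} h
  ... | inj₁ pts = let (p , fp) = anyFin⁻ (f ∘ inj₁) pts in inj₁ p , fp
  ... | inj₂ lns = let (L , fL) = anyFin⁻ (f ∘ inj₂) lns in inj₂ L , fL

  anyElt⁺ : (f : Elt Γ → Bool) → ∀ z → f z ≡ true → anyElt Γ f ≡ true
  anyElt⁺ f (inj₁ p) h = ∨⁺ˡ _ (anyFin⁺ (f ∘ inj₁) p h)
  anyElt⁺ f (inj₂ L) h = ∨⁺ʳ (anyFin (f ∘ inj₁)) (anyFin⁺ (f ∘ inj₂) L h)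

  Within-0⁻ : ∀ {a b} → Within 0 a b → a ≡ b
  Within-0⁻ {a} {b} (mkWithin h) with ≡-dec Fin._≟_ Fin._≟_ a b
  ... | yes a≡b = a≡b
  ... | no  _   with () ← h

  Within-refl : ∀ a → Within 0 a a
  Within-refl a = mkWithin (isYes-refl (≡-dec Fin._≟_ Fin._≟_ a a))
    where isYes-refl : (a≟a : Dec (a ≡ a)) → ⌊ a≟a ⌋ ≡ true
          isYes-refl (yes _)  = refl
          isYes-refl (no a≢a) = ⊥-elim (a≢a refl)

  Within-suc : ∀ {k a b} → Within k a b → Within (suc k) a b
  Within-suc (mkWithin h) = mkWithin (∨⁺ˡ _ h)

  Within-∷ : ∀ {k a z b} → Adj a z → Within k z b → Within (suc k) a b
  Within-∷ {k} {a} {z} {b} (adjacent az) (mkWithin zb) =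
    mkWithin (∨⁺ʳ (within Γ k a b) (anyElt⁺ (λ z → adj Γ a z ∧ within Γ k z b) z (∧⁺ az zb)))

  Within-suc⁻ : ∀ {k a b} → Within (suc k) a b → Within k a b ⊎ (∃ λ z → Adj a z × Within k z b)
  Within-suc⁻ {k} {a} {b} (mkWithin h) with ∨⁻ {within Γ k a b} h
  ... | inj₁ ab   = inj₁ (mkWithin ab)
  ... | inj₂ step =
    let (z , azb) = anyElt⁻ (λ z → adj Γ a z ∧ within Γ k z b) step
    in  inj₂ (z , adjacent (proj₁ (∧⁻ azb)) , mkWithin (proj₂ (∧⁻ azb)))

  Within-mono : ∀ {j k a b} → j ≤ k → Within j a b → Within k a b
  Within-mono {zero}  {zero}  _ h = h
  Within-mono {zero}  {suc k} _ h = Within-suc (Within-mono {zero} {k} z≤n h)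
  Within-mono {suc j} {suc k} (s≤s j≤k) h with Within-suc⁻ h
  ... | inj₁ ab            = Within-suc (Within-mono j≤k ab)
  ... | inj₂ (z , az , zb) = Within-∷ az (Within-mono j≤k zb)

  Within-∷ʳ : ∀ {k a z b} → Within k a z → Adj z b → Within (suc k) a b
  Within-∷ʳ {zero}  {a} {z} {b} az zb rewrite Within-0⁻ az = Within-∷ zb (Within-refl b)
  Within-∷ʳ {suc k} az zb with Within-suc⁻ az
  ... | inj₁ az′             = Within-suc (Within-∷ʳ az′ zb)
  ... | inj₂ (y , ay , yz)   = Within-∷ ay (Within-∷ʳ yz zb)

  Within-sym : ∀ {k a b} → Within k a b → Within k b a
  Within-sym {zero}  {a} {b} ab rewrite Within-0⁻ ab = Within-refl b
  Within-sym {suc k} ab with Within-suc⁻ ab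
  ... | inj₁ ab′           = Within-suc (Within-sym ab′)
  ... | inj₂ (z , az , zb) = Within-∷ʳ (Within-sym zb) (Adj-sym az)

  Within-trans : ∀ {j k a b c} → Within j a b → Within k b c → Within (j + k) a c
  Within-trans {zero}  ab bc rewrite Within-0⁻ ab = bc
  Within-trans {suc j} ab bc with Within-suc⁻ ab
  ... | inj₁ ab′           = Within-suc (Within-trans ab′ bc)
  ... | inj₂ (z , az , zb) = Within-∷ az (Within-trans zb bc)

  Dist⇒Within : ∀ {a b d} → Dist a b d → Within d a b
  Dist⇒Within {d = zero}  (mkDist h) = mkWithin h
  Dist⇒Within {d = suc d} (mkDist h) = mkWithin (proj₁ (∧⁻ h))

  Dist-suc⇒¬Within : ∀ {a b d} → Dist a b (suc d) → ¬ Within d a b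
  Dist-suc⇒¬Within {a} {b} {d} (mkDist h) (mkWithin ab) = not-true (proj₂ (∧⁻ {within Γ (suc d) a b} h)) ab

  Dist-minimal : ∀ {a b d j} → Dist a b d → Within j a b → d ≤ j
  Dist-minimal {d = zero} _ _ = z≤n
  Dist-minimal {d = suc d} {j} ab≡d ab with suc d ≤? j
  ... | yes d<j = d<j
  ... | no  d≮j = ⊥-elim (Dist-suc⇒¬Within ab≡d (Within-mono (≤-pred (≰⇒> d≮j)) ab))

  Dist-intro : ∀ {a b d} → Within d a b → (∀ j → Within j a b → d ≤ j) → Dist a b d
  Dist-intro {d = zero} (mkWithin h) _ = mkDist h
  Dist-intro {a} {b} {suc d} (mkWithin h) minimal = by-cases _ refl
    where by-cases : ∀ x → within Γ d a b ≡ x → Dist a b (suc d)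
          by-cases true  eq = ⊥-elim (1+n≰n (minimal d (mkWithin eq)))
          by-cases false eq = mkDist (∧⁺ h (cong not eq))

  Dist-unique : ∀ {a b d d′} → Dist a b d → Dist a b d′ → d ≡ d′
  Dist-unique h h′ = ≤-antisym (Dist-minimal h (Dist⇒Within h′)) (Dist-minimal h′ (Dist⇒Within h))

  Within⇒Dist : ∀ {k a b} → Within k a b → ∃ λ d → Dist a b d × d ≤ k
  Within⇒Dist {zero}  (mkWithin h) = 0 , mkDist h , z≤n
  Within⇒Dist {suc k} {a} {b} (mkWithin h) = by-cases _ refl
    where
    by-cases : ∀ x → within Γ k a b ≡ x → ∃ λ d → Dist a b d × d ≤ suc k
    by-cases true  eq = let (d , ab≡d , d≤k) = Within⇒Dist (mkWithin eq) in d , ab≡d , m≤n⇒m≤1+n d≤k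
    by-cases false eq = suc k , mkDist (∧⁺ h (cong not eq)) , ≤-refl

  Dist-0⁻ : ∀ {a b} → Dist a b 0 → a ≡ b
  Dist-0⁻ (mkDist h) = Within-0⁻ (mkWithin h)

  Dist-pred : ∀ {a b d} → Dist a b (suc d) → ∃ λ b′ → Adj b′ b × Dist a b′ d
  Dist-pred {a} {b} {d} ab≡d with Within-suc⁻ (Within-sym (Dist⇒Within ab≡d))
  ... | inj₁ ba = ⊥-elim (1+n≰n (Dist-minimal ab≡d (Within-sym ba)))
  ... | inj₂ (b′ , bb′ , b′a) = b′ , Adj-sym bb′ , Dist-intro (Within-sym b′a) minimal
    where
    minimal : ∀ j → Within j a b′ → d ≤ j
    minimal j ab′ = ≤-pred (Dist-minimal ab≡d (Within-∷ʳ ab′ (Adj-sym bb′)))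

  Dist-isPoint : ∀ {a b d} → Dist a b d → isPoint b ≡ alternate d (isPoint a)
  Dist-isPoint {d = zero}  ab≡0 rewrite Dist-0⁻ ab≡0 = refl
  Dist-isPoint {d = suc d} ab≡d with Dist-pred ab≡d
  ... | b′ , b′b , ab′≡d = trans (Adj-isPoint b′b) (cong not (Dist-isPoint ab′≡d))

  Adj⇒¬same-Dist : ∀ {v a b d} → Adj a b → Dist v a d → ¬ Dist v b d
  Adj⇒¬same-Dist ab va vb = not-¬ (trans (Dist-isPoint vb) (sym (Dist-isPoint va))) (Adj-isPoint ab)

  Adj⇒Dist-suc : ∀ {v a b d d′} → Adj a b → Dist v a d → Dist v b d′ → d′ ≡ suc d ⊎ d ≡ suc d′
  Adj⇒Dist-suc {d = d} {d′} ab va vb with <-cmp d d′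
  ... | tri< d<d′ _ _ = inj₁ (≤-antisym (Dist-minimal vb (Within-∷ʳ (Dist⇒Within va) ab)) d<d′)
  ... | tri≈ _ refl _ = ⊥-elim (Adj⇒¬same-Dist ab va vb)
  ... | tri> _ _ d>d′ = inj₂ (≤-antisym (Dist-minimal va (Within-∷ʳ (Dist⇒Within vb) (Adj-sym ab))) d>d′)

  Dist-rebase : ∀ {v w x i j} → Dist v w i → Dist v x (i + j) → Within j w x → Dist w x j
  Dist-rebase {i = i} vw vx wx =
    Dist-intro wx (λ j′ wx′ → +-cancelˡ-≤ i _ _ (Dist-minimal vx (Within-trans (Dist⇒Within vw) wx′)))

module Cycles (Γ : Geometry) where
  open Distance Γ

  record ChordlessCycle (k : ℕ) (c : ℕ → Elt Γ) : Set where
    field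
      step      : ∀ j → j < k + k → Adj (c j) (c (cyclicSuc (k + k) j))
      injective : ∀ i j → i < k + k → j < k + k → c i ≡ c j → i ≡ j
      chordless : ∀ i j → i < k + k → j < k + k → Adj (c i) (c j) →
                  j ≡ cyclicSuc (k + k) i ⊎ i ≡ cyclicSuc (k + k) j

  ChordlessCycle-rotate : ∀ {k c} → ChordlessCycle k c → ChordlessCycle k (c ∘ cyclicSuc (k + k))
  ChordlessCycle-rotate {k} {c} C = record
    { step      = λ j j<K → step _ (cyclicSuc-bounded j<K)
    ; injective = λ i j i<K j<K eq →
        cyclicSuc-injective i<K j<K (injective _ _ (cyclicSuc-bounded i<K) (cyclicSuc-bounded j<K) eq)
    ; chordless = chordless′
    }
    where
    open ChordlessCycle C
    K : ℕ
    K = k + k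
    chordless′ : ∀ i j → i < K → j < K → Adj (c (cyclicSuc K i)) (c (cyclicSuc K j)) →
                 j ≡ cyclicSuc K i ⊎ i ≡ cyclicSuc K j
    chordless′ i j i<K j<K a with chordless _ _ (cyclicSuc-bounded i<K) (cyclicSuc-bounded j<K) a
    ... | inj₁ eq = inj₁ (cyclicSuc-injective j<K (cyclicSuc-bounded i<K) eq)
    ... | inj₂ eq = inj₂ (cyclicSuc-injective i<K (cyclicSuc-bounded j<K) eq)

  ChordlessCycle-isPoint : ∀ {k c} → ChordlessCycle k c → ∀ j → j < k + k → isPoint (c j) ≡ alternate j (isPoint (c 0))
  ChordlessCycle-isPoint C zero    _ = refl
  ChordlessCycle-isPoint {k} {c} C (suc j) j+1<K =
    trans (subst (λ i → isPoint (c i) ≡ not (isPoint (c j))) (cyclicSuc-< j+1<K) (Adj-isPoint (step j j<K)))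
          (cong not (ChordlessCycle-isPoint C j j<K))
    where
    open ChordlessCycle C
    j<K : j < k + k
    j<K = <-trans (n<1+n j) j+1<K

  asPoint : ∀ e → isPoint e ≡ true → Σ (Pt Γ) λ p → e ≡ inj₁ p
  asPoint (inj₁ p) _ = p , refl

  asLine : ∀ e → isPoint e ≡ false → Σ (Ln Γ) λ L → e ≡ inj₂ L
  asLine (inj₂ L) _ = L , refl

  pointedCycle⇒OrdinaryGon : ∀ {k c} → ChordlessCycle (suc k) c → isPoint (c 0) ≡ true → OrdinaryGon Γ (suc k)
  pointedCycle⇒OrdinaryGon {k} {c} C c₀-point = record
    { pts = proj₁ ∘ point ; lns = proj₁ ∘ line
    ; pts-inj = pts-inj ; lns-inj = lns-inj
    ; inc = inc ; inc₁ = inc₁ ; inc₂ = inc₂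
    }
    where
    open ChordlessCycle C
    K : ℕ
    K = suc k
    even< : (i : Fin K) → toℕ i + toℕ i < K + K
    even< i = double-< (toℕ<n i)
    odd< : (i : Fin K) → suc (toℕ i + toℕ i) < K + K
    odd< i = double-<-odd (toℕ<n i)
    point : (i : Fin K) → Σ (Pt Γ) λ p → c (toℕ i + toℕ i) ≡ inj₁ p
    point i = asPoint _ (trans (ChordlessCycle-isPoint C _ (even< i))
                               (trans (alternate-even (toℕ i) _) c₀-point))
    line : (i : Fin K) → Σ (Ln Γ) λ L → c (suc (toℕ i + toℕ i)) ≡ inj₂ L
    line i = asLine _ (trans (ChordlessCycle-isPoint C _ (odd< i))
                             (cong not (trans (alternate-even (toℕ i) _) c₀-point)))
    pts-inj : ∀ {i j} → proj₁ (point i) ≡ proj₁ (point j) → i ≡ j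
    pts-inj {i} {j} eq = toℕ-injective (double-injective (injective _ _ (even< i) (even< j)
      (trans (proj₂ (point i)) (trans (cong inj₁ eq) (sym (proj₂ (point j)))))))
    lns-inj : ∀ {i j} → proj₁ (line i) ≡ proj₁ (line j) → i ≡ j
    lns-inj {i} {j} eq = toℕ-injective (double-injective (suc-injective (injective _ _ (odd< i) (odd< j)
      (trans (proj₂ (line i)) (trans (cong inj₂ eq) (sym (proj₂ (line j))))))))
    inc : ∀ i j → Geometry.I Γ (proj₁ (point i)) (proj₁ (line j)) ≡ true → j ≡ i ⊎ i ≡ next j
    inc i j h with chordless _ _ (even< i) (odd< j) (subst₂ Adj (sym (proj₂ (point i))) (sym (proj₂ (line j))) (adjacent h))
    ... | inj₁ eq = inj₁ (toℕ-injective (double-injective (suc-injective (trans eq (cyclicSuc-< (odd< i))))))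
    ... | inj₂ eq = inj₂ (toℕ-injective (double-injective (trans eq (cyclicSuc-odd-next j))))
    inc₁ : ∀ i → Geometry.I Γ (proj₁ (point i)) (proj₁ (line i)) ≡ true
    inc₁ i = adj≡true (subst₂ Adj (proj₂ (point i)) (proj₂ (line i))
      (subst (λ n → Adj (c (toℕ i + toℕ i)) (c n)) (cyclicSuc-< (odd< i)) (step _ (even< i))))
    inc₂ : ∀ j → Geometry.I Γ (proj₁ (point (next j))) (proj₁ (line j)) ≡ true
    inc₂ j = adj≡true (subst₂ Adj (proj₂ (point (next j))) (proj₂ (line j)) (Adj-sym
      (subst (λ n → Adj (c (suc (toℕ j + toℕ j))) (c n)) (cyclicSuc-odd-next j) (step _ (odd< j)))))

  ChordlessCycle⇒OrdinaryGon : ∀ {k c} → ChordlessCycle (suc k) c → OrdinaryGon Γ (suc k)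
  ChordlessCycle⇒OrdinaryGon {k} {c} C with isPoint (c 0) in c₀
  ... | true  = pointedCycle⇒OrdinaryGon C c₀
  ... | false = pointedCycle⇒OrdinaryGon (ChordlessCycle-rotate C)
                  (trans (Adj-isPoint (ChordlessCycle.step C 0 (s≤s z≤n))) (cong not c₀))

module Geodesics (Γ : Geometry) where
  open Distance Γ
  open Cycles Γ

  record Geodesic (v y : Elt Γ) (e : ℕ) : Set where
    field
      path      : ℕ → Elt Γ
      path-end  : path e ≡ y
      path-step : ∀ i → i < e → Adj (path i) (path (suc i))
      path-dist : ∀ i → i ≤ e → Dist v (path i) i
      path-rest : ∀ i → i ≤ e → Within (e ∸ i) (path i) y

  extend : (ℕ → Elt Γ) → ℕ → Elt Γ → ℕ → Elt Γ
  extend p e y i with i ≤? e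
  ... | yes _ = p i
  ... | no  _ = y

  extend-≤ : ∀ p e y {i} → i ≤ e → extend p e y i ≡ p i
  extend-≤ p e y {i} i≤e with i ≤? e
  ... | yes _   = refl
  ... | no  i≰e = ⊥-elim (i≰e i≤e)

  extend-suc : ∀ p e y → extend p e y (suc e) ≡ y
  extend-suc p e y with suc e ≤? e
  ... | yes e<e = ⊥-elim (1+n≰n e<e)
  ... | no  _   = refl

  geodesic : ∀ {v y} e → Dist v y e → Geodesic v y e
  geodesic {v} {y} zero vy = record
    { path = λ _ → y ; path-end = refl ; path-step = λ _ ()
    ; path-dist = λ { .0 z≤n → vy } ; path-rest = λ { .0 z≤n → Within-refl y } }
  geodesic {v} {y} (suc e) vy with Dist-pred vy
  ... | y′ , y′y , vy′ = record
    { path = p ; path-end = extend-suc p′ e y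
    ; path-step = step ; path-dist = dist ; path-rest = rest }
    where
    open Geodesic (geodesic e vy′) renaming (path to p′)
    p : ℕ → Elt Γ
    p = extend p′ e y
    p′e~y : Adj (p′ e) y
    p′e~y = subst (λ w → Adj w y) (sym path-end) y′y
    step : ∀ i → i < suc e → Adj (p i) (p (suc i))
    step i (s≤s i≤e) with m≤n⇒m<n∨m≡n i≤e
    ... | inj₁ i<e  rewrite extend-≤ p′ e y i≤e | extend-≤ p′ e y i<e = path-step i i<e
    ... | inj₂ refl rewrite extend-≤ p′ e y i≤e | extend-suc p′ e y = p′e~y
    dist : ∀ i → i ≤ suc e → Dist v (p i) i
    dist i i≤e+1 with m≤n⇒m<n∨m≡n i≤e+1
    ... | inj₁ (s≤s i≤e) rewrite extend-≤ p′ e y i≤e = path-dist i i≤e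
    ... | inj₂ refl      rewrite extend-suc p′ e y = vy
    rest : ∀ i → i ≤ suc e → Within (suc e ∸ i) (p i) y
    rest i i≤e+1 with m≤n⇒m<n∨m≡n i≤e+1
    ... | inj₁ (s≤s i≤e) rewrite extend-≤ p′ e y i≤e | +-∸-assoc 1 i≤e = Within-∷ʳ (path-rest i i≤e) y′y
    ... | inj₂ refl      rewrite extend-suc p′ e y | n∸n≡0 e = Within-refl y

  record Fork (v u : Elt Γ) (e : ℕ) : Set where
    constructor fork
    field
      {y z} : Elt Γ
      y≢z   : y ≢ z
      y~u   : Adj y u
      z~u   : Adj z u
      v-y   : Dist v y e
      v-z   : Dist v z e
      v-u   : Dist v u (suc e)

  module ForkCycle {v u y z : Elt Γ} {E : ℕ} (P : Geodesic v y E) (Q : Geodesic v z E)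
    (y~u : Adj y u) (z~u : Adj z u) (v-u : Dist v u (suc E))
    (disjoint : ∀ i → 1 ≤ i → i ≤ E → Geodesic.path P i ≢ Geodesic.path Q i)
    (no-lower-fork : ∀ a → a < E → ∀ {x} → ¬ Fork v x a)
    (1≤E : 1 ≤ E)
    where

    -- The closed walk v = p 0, …, p E = y, u, z = q E, …, q 1 of length 2E + 2:
    -- position j ≤ E carries p j, position E + 1 carries u, position K ∸ b carries q b.
    open Geodesic P using () renaming (path to p; path-step to p-step; path-dist to p-dist)
    open Geodesic Q using () renaming (path to q; path-step to q-step; path-dist to q-dist)

    K : ℕ
    K = suc E + suc E

    K≡ : K ≡ suc (suc E) + E
    K≡ = cong suc (+-suc E E)

    1+E<K : suc E < K
    1+E<K = subst (suc E <_) (sym K≡) (m≤m+n (suc (suc E)) E)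

    ≤E⇒<K : ∀ {b} → b ≤ E → b < K
    ≤E⇒<K b≤E = <-trans (s≤s b≤E) 1+E<K

    K∸E : K ∸ E ≡ suc (suc E)
    K∸E = trans (cong (_∸ E) K≡) (m+n∸n≡m (suc (suc E)) E)

    K∸1+E : K ∸ suc E ≡ suc E
    K∸1+E = m+n∸n≡m (suc E) (suc E)

    2+E≤K∸ : ∀ {b} → b ≤ E → suc (suc E) ≤ K ∸ b
    2+E≤K∸ {b} b≤E = subst (_≤ K ∸ b) K∸E (∸-monoʳ-≤ K b≤E)

    cycle : ℕ → Elt Γ
    cycle j with j ≤? E | j ≟ suc E
    ... | yes _ | _     = p j
    ... | no  _ | yes _ = u
    ... | no  _ | no  _ = q (K ∸ j)

    data Position : ℕ → Set where
      onP : ∀ {i} → i ≤ E → Position i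
      atU : Position (suc E)
      onQ : ∀ {b} → 1 ≤ b → b ≤ E → Position (K ∸ b)

    position : ∀ j → j < K → Position j
    position j j<K with j ≤? E | j ≟ suc E
    ... | yes j≤E | _      = onP j≤E
    ... | no  _   | yes refl = atU
    ... | no  j≰E | no  j≢1+E = subst Position (m∸[m∸n]≡n (<⇒≤ j<K)) (onQ (m<n⇒0<n∸m j<K) K∸j≤E)
      where
      K∸j≤E : K ∸ j ≤ E
      K∸j≤E = subst (K ∸ j ≤_) (trans (cong (_∸ suc (suc E)) K≡) (m+n∸m≡n (suc (suc E)) E))
                    (∸-monoʳ-≤ K (≤∧≢⇒< (≰⇒> j≰E) (j≢1+E ∘ sym)))

    element : ∀ {j} → Position j → Elt Γ
    element (onP {i} _)   = p i
    element atU           = u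
    element (onQ {b} _ _) = q b

    level : ∀ {j} → Position j → ℕ
    level (onP {i} _)   = i
    level atU           = suc E
    level (onQ {b} _ _) = b

    cycle-element : ∀ {j} (w : Position j) → cycle j ≡ element w
    cycle-element (onP {i} i≤E) with i ≤? E
    ... | yes _   = refl
    ... | no  i≰E = ⊥-elim (i≰E i≤E)
    cycle-element atU with suc E ≤? E | suc E ≟ suc E
    ... | yes E<E | _          = ⊥-elim (1+n≰n E<E)
    ... | no  _   | yes _      = refl
    ... | no  _   | no  E≢E    = ⊥-elim (E≢E refl)
    cycle-element (onQ {b} _ b≤E) with K ∸ b ≤? E | K ∸ b ≟ suc E
    ... | yes K∸b≤E | _ = ⊥-elim (1+n≰n (≤-trans (m≤n⇒m≤1+n (2+E≤K∸ b≤E)) (s≤s K∸b≤E)))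
    ... | no  _ | yes K∸b≡1+E = ⊥-elim (1+n≰n (subst (suc (suc E) ≤_) K∸b≡1+E (2+E≤K∸ b≤E)))
    ... | no  _ | no  _       = cong q (m∸[m∸n]≡n (<⇒≤ (≤E⇒<K b≤E)))

    element-Dist : ∀ {j} (w : Position j) → Dist v (element w) (level w)
    element-Dist (onP i≤E)   = p-dist _ i≤E
    element-Dist atU         = v-u
    element-Dist (onQ _ b≤E) = q-dist _ b≤E

    p0≡q0 : p 0 ≡ q 0
    p0≡q0 = trans (sym (Dist-0⁻ (p-dist 0 z≤n))) (Dist-0⁻ (q-dist 0 z≤n))

    Adj-on-cycle : ∀ {i j} (wi : Position i) (wj : Position j) → Adj (element wi) (element wj) → Adj (cycle i) (cycle j)
    Adj-on-cycle wi wj = subst₂ Adj (sym (cycle-element wi)) (sym (cycle-element wj))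

    cyclicSuc-1+E : cyclicSuc K (suc E) ≡ K ∸ E
    cyclicSuc-1+E = trans (cong (cyclicSuc K) (sym K∸1+E)) (cyclicSuc-∸ 1≤E (≤E⇒<K ≤-refl))

    step-via-elements : ∀ {j n} → cyclicSuc K j ≡ n → (wj : Position j) (wn : Position n) →
                        Adj (element wj) (element wn) → Adj (cycle j) (cycle (cyclicSuc K j))
    step-via-elements {j} eq wj wn a = subst (λ k → Adj (cycle j) (cycle k)) (sym eq) (Adj-on-cycle wj wn a)

    step : ∀ j → j < K → Adj (cycle j) (cycle (cyclicSuc K j))
    step j j<K with position j j<K
    ... | onP {i} i≤E with m≤n⇒m<n∨m≡n i≤E
    ...   | inj₁ i<E  = step-via-elements (cyclicSuc-< (≤E⇒<K i<E)) (onP i≤E) (onP i<E) (p-step i i<E)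
    ...   | inj₂ refl = step-via-elements (cyclicSuc-< 1+E<K) (onP i≤E) atU
                          (subst (λ w → Adj w u) (sym (Geodesic.path-end P)) y~u)
    step j j<K | atU = step-via-elements cyclicSuc-1+E atU (onQ 1≤E ≤-refl)
              (Adj-sym (subst (λ w → Adj w u) (sym (Geodesic.path-end Q)) z~u))
    step j j<K | onQ {suc zero} 1≤b b≤E =
      step-via-elements (cyclicSuc-last (≤-<-trans z≤n 1+E<K)) (onQ 1≤b b≤E) (onP z≤n)
              (subst (Adj (q 1)) (sym p0≡q0) (Adj-sym (q-step 0 b≤E)))
    step j j<K | onQ {suc (suc b)} 1≤b b≤E =
      step-via-elements (cyclicSuc-∸ (s≤s z≤n) (≤E⇒<K (<⇒≤ b≤E))) (onQ 1≤b b≤E) (onQ (s≤s z≤n) (<⇒≤ b≤E))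
              (Adj-sym (q-step (suc b) b≤E))

    element-≡ : ∀ {i j} (wi : Position i) (wj : Position j) → cycle i ≡ cycle j → element wi ≡ element wj
    element-≡ wi wj eq = trans (sym (cycle-element wi)) (trans eq (cycle-element wj))

    same-level : ∀ {i j} (wi : Position i) (wj : Position j) → cycle i ≡ cycle j → level wi ≡ level wj
    same-level wi wj eq = Dist-unique (subst (λ w → Dist v w _) (element-≡ wi wj eq) (element-Dist wi)) (element-Dist wj)

    cycle-P≢Q : ∀ {i b} (i≤E : i ≤ E) (1≤b : 1 ≤ b) (b≤E : b ≤ E) → cycle i ≢ cycle (K ∸ b)
    cycle-P≢Q i≤E 1≤b b≤E eq with same-level (onP i≤E) (onQ 1≤b b≤E) eq
    ... | refl = disjoint _ 1≤b b≤E (element-≡ (onP i≤E) (onQ 1≤b b≤E) eq)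

    positions-injective : ∀ {i j} (wi : Position i) (wj : Position j) → cycle i ≡ cycle j → i ≡ j
    positions-injective (onP i≤E) (onP j≤E) eq = same-level (onP i≤E) (onP j≤E) eq
    positions-injective (onP i≤E) atU eq =
      ⊥-elim (1+n≰n (subst (_≤ E) (same-level (onP i≤E) atU eq) i≤E))
    positions-injective atU (onP j≤E) eq =
      ⊥-elim (1+n≰n (subst (_≤ E) (same-level (onP j≤E) atU (sym eq)) j≤E))
    positions-injective (onP i≤E) (onQ 1≤b b≤E) eq = ⊥-elim (cycle-P≢Q i≤E 1≤b b≤E eq)
    positions-injective (onQ 1≤b b≤E) (onP j≤E) eq = ⊥-elim (cycle-P≢Q j≤E 1≤b b≤E (sym eq))
    positions-injective atU atU eq = refl
    positions-injective atU (onQ 1≤b b≤E) eq =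
      ⊥-elim (1+n≰n (subst (_≤ E) (sym (same-level atU (onQ 1≤b b≤E) eq)) b≤E))
    positions-injective (onQ 1≤b b≤E) atU eq =
      ⊥-elim (1+n≰n (subst (_≤ E) (same-level (onQ 1≤b b≤E) atU eq) b≤E))
    positions-injective (onQ 1≤b b≤E) (onQ 1≤b′ b′≤E) eq =
      cong (K ∸_) (same-level (onQ 1≤b b≤E) (onQ 1≤b′ b′≤E) eq)

    Consecutive : ℕ → ℕ → Set
    Consecutive i j = j ≡ cyclicSuc K i ⊎ i ≡ cyclicSuc K j

    Adj⇒level-suc : ∀ {i j} (wi : Position i) (wj : Position j) → Adj (element wi) (element wj) →
                    level wj ≡ suc (level wi) ⊎ level wi ≡ suc (level wj)
    Adj⇒level-suc wi wj a = Adj⇒Dist-suc a (element-Dist wi) (element-Dist wj)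

    Adj-P-U⇒Consecutive : ∀ {i} → i ≤ E → Adj (p i) u → Consecutive i (suc E)
    Adj-P-U⇒Consecutive i≤E a with Adj⇒level-suc (onP i≤E) atU a
    ... | inj₁ refl = inj₁ (sym (cyclicSuc-< 1+E<K))
    ... | inj₂ refl = ⊥-elim (1+n≰n (≤-trans (n≤1+n _) i≤E))

    Adj-P-Q⇒Consecutive : ∀ {i b} (i≤E : i ≤ E) (1≤b : 1 ≤ b) (b≤E : b ≤ E) → Adj (p i) (q b) → Consecutive i (K ∸ b)
    Adj-P-Q⇒Consecutive {i} {b} i≤E 1≤b b≤E a with Adj⇒level-suc (onP i≤E) (onQ 1≤b b≤E) a
    Adj-P-Q⇒Consecutive {zero}  i≤E 1≤b b≤E a | inj₁ refl = inj₂ (sym (cyclicSuc-last (≤-<-trans z≤n 1+E<K)))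
    Adj-P-Q⇒Consecutive {suc i} i≤E 1≤b b≤E a | inj₁ refl = ⊥-elim (no-lower-fork (suc i) b≤E
      (fork (disjoint (suc i) (s≤s z≤n) i≤E) a (q-step (suc i) b≤E)
            (p-dist (suc i) i≤E) (q-dist (suc i) (<⇒≤ b≤E)) (q-dist (suc (suc i)) b≤E)))
    Adj-P-Q⇒Consecutive {suc i} {b} i≤E 1≤b b≤E a | inj₂ refl = ⊥-elim (no-lower-fork b i≤E
      (fork (disjoint b 1≤b b≤E) (p-step b i≤E) (Adj-sym a)
            (p-dist b b≤E) (q-dist b b≤E) (p-dist (suc b) i≤E)))

    Adj-U-Q⇒Consecutive : ∀ {b} (1≤b : 1 ≤ b) (b≤E : b ≤ E) → Adj u (q b) → Consecutive (suc E) (K ∸ b)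
    Adj-U-Q⇒Consecutive 1≤b b≤E a with Adj⇒level-suc atU (onQ 1≤b b≤E) a
    ... | inj₁ refl = ⊥-elim (1+n≰n (≤-trans (n≤1+n _) b≤E))
    ... | inj₂ refl = inj₁ (sym cyclicSuc-1+E)

    Adj-Q-Q⇒Consecutive : ∀ {b b′} (1≤b : 1 ≤ b) (b≤E : b ≤ E) (1≤b′ : 1 ≤ b′) (b′≤E : b′ ≤ E) →
                          Adj (q b) (q b′) → Consecutive (K ∸ b) (K ∸ b′)
    Adj-Q-Q⇒Consecutive 1≤b b≤E 1≤b′ b′≤E a with Adj⇒level-suc (onQ 1≤b b≤E) (onQ 1≤b′ b′≤E) a
    ... | inj₁ refl = inj₂ (sym (cyclicSuc-∸ 1≤b (≤E⇒<K b≤E)))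
    ... | inj₂ refl = inj₁ (sym (cyclicSuc-∸ 1≤b′ (≤E⇒<K b′≤E)))

    Adj⇒Consecutive : ∀ {i j} (wi : Position i) (wj : Position j) → Adj (element wi) (element wj) → Consecutive i j
    Adj⇒Consecutive (onP i≤E) (onP j≤E) a with Adj⇒level-suc (onP i≤E) (onP j≤E) a
    ... | inj₁ refl = inj₁ (sym (cyclicSuc-< (≤E⇒<K j≤E)))
    ... | inj₂ refl = inj₂ (sym (cyclicSuc-< (≤E⇒<K i≤E)))
    Adj⇒Consecutive (onP i≤E) atU a                   = Adj-P-U⇒Consecutive i≤E a
    Adj⇒Consecutive atU (onP j≤E) a                   = swap (Adj-P-U⇒Consecutive j≤E (Adj-sym a))
    Adj⇒Consecutive (onP i≤E) (onQ 1≤b b≤E) a         = Adj-P-Q⇒Consecutive i≤E 1≤b b≤E a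
    Adj⇒Consecutive (onQ 1≤b b≤E) (onP j≤E) a         = swap (Adj-P-Q⇒Consecutive j≤E 1≤b b≤E (Adj-sym a))
    Adj⇒Consecutive atU atU a                         = ⊥-elim (Adj⇒¬same-Dist a v-u v-u)
    Adj⇒Consecutive atU (onQ 1≤b b≤E) a               = Adj-U-Q⇒Consecutive 1≤b b≤E a
    Adj⇒Consecutive (onQ 1≤b b≤E) atU a               = swap (Adj-U-Q⇒Consecutive 1≤b b≤E (Adj-sym a))
    Adj⇒Consecutive (onQ 1≤b b≤E) (onQ 1≤b′ b′≤E) a = Adj-Q-Q⇒Consecutive 1≤b b≤E 1≤b′ b′≤E a

    cycle-chordless : ChordlessCycle (suc E) cycle
    cycle-chordless = record
      { step      = step
      ; injective = λ i j i<K j<K → positions-injective (position i i<K) (position j j<K)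
      ; chordless = λ i j i<K j<K a →
          Adj⇒Consecutive (position i i<K) (position j j<K)
            (subst₂ Adj (cycle-element (position i i<K)) (cycle-element (position j j<K)) a)
      }

  fork-at-meeting : ∀ {v u e i} (F : Fork v u (suc e)) →
                    (P : Geodesic v (Fork.y F) (suc e)) (Q : Geodesic v (Fork.z F) (suc e)) → i < suc e →
                    Geodesic.path P (suc i) ≡ Geodesic.path Q (suc i) → Fork (Geodesic.path P (suc i)) u (e ∸ i)
  fork-at-meeting {v} {u} {e} {i} (fork {z = z} y≢z y~u z~u v-y v-z v-u) P Q i<E meet =
    fork y≢z y~u z~u (rebased P v-y) (subst (λ w → Dist w z (e ∸ i)) (sym meet) (rebased Q v-z)) w-u
    where
    E≡ : suc e ≡ suc i + (e ∸ i)
    E≡ = cong suc (sym (m+[n∸m]≡n (≤-pred i<E)))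
    rebased : ∀ {x} (R : Geodesic v x (suc e)) → Dist v x (suc e) → Dist (Geodesic.path R (suc i)) x (e ∸ i)
    rebased R v-x = Dist-rebase (Geodesic.path-dist R (suc i) i<E) (subst (Dist v _) E≡ v-x)
                                (Geodesic.path-rest R (suc i) i<E)
    w-u : Dist (Geodesic.path P (suc i)) u (suc (e ∸ i))
    w-u = Dist-rebase (Geodesic.path-dist P (suc i) i<E)
            (subst (Dist v u) (trans (cong suc E≡) (sym (+-suc (suc i) (e ∸ i)))) v-u)
            (Within-∷ʳ (Geodesic.path-rest P (suc i) i<E) y~u)

  no-fork : ∀ {M} → (∀ k → 2 ≤ k → k < M → ¬ OrdinaryGon Γ k) → ∀ e → suc e < M → ∀ {v u} → ¬ Fork v u e
  no-fork {M} no-small-gons = <-rec (λ e → suc e < M → ∀ {v u} → ¬ Fork v u e) no-fork-at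
    where
    no-fork-at : ∀ e → (∀ {a} → a < e → suc a < M → ∀ {v u} → ¬ Fork v u a) →
                 suc e < M → ∀ {v u} → ¬ Fork v u e
    no-fork-at zero _ _ (fork y≢z _ _ v-y v-z _) = y≢z (trans (sym (Dist-0⁻ v-y)) (Dist-0⁻ v-z))
    no-fork-at (suc e) no-lower-fork E<M {v} {u} F@(fork {y} {z} y≢z y~u z~u v-y v-z v-u) =
      meet-or-cycle (geodesic (suc e) v-y) (geodesic (suc e) v-z)
      where
      open Geodesic using (path)
      -- Either the geodesics to y and z meet again, giving a fork of lower level based at the
      -- meeting point, or they close up through u into a cycle of length 2e + 4, which is
      -- chordless because a chord would be a fork of lower level.
      meet-or-cycle : Geodesic v y (suc e) → Geodesic v z (suc e) → ⊥
      meet-or-cycle P Q with anyUpTo? (λ i → ≡-dec Fin._≟_ Fin._≟_ (path P (suc i)) (path Q (suc i))) (suc e)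
      ... | yes (i , i<E , meet) =
        no-lower-fork (s≤s (m∸n≤m e i)) (≤-<-trans (s≤s (m∸n≤m e i)) (<-trans (n<1+n _) E<M))
                      (fork-at-meeting F P Q i<E meet)
      ... | no apart = no-small-gons (suc (suc e)) (s≤s (s≤s z≤n)) E<M
                         (ChordlessCycle⇒OrdinaryGon (ForkCycle.cycle-chordless P Q y~u z~u v-u disjoint lower (s≤s z≤n)))
        where
        disjoint : ∀ i → 1 ≤ i → i ≤ suc e → path P i ≢ path Q i
        disjoint (suc i) _ i<E meet = apart (i , i<E , meet)
        lower : ∀ a → a < suc e → ∀ {x} → ¬ Fork v x a
        lower a a<E = no-lower-fork a<E (<-trans (s≤s a<E) E<M)

module GonWalks (Γ : Geometry) {k : ℕ} (G : OrdinaryGon Γ (suc k)) where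
  open Distance Γ
  open OrdinaryGon G

  K : ℕ
  K = suc k

  point line : ℕ → Elt Γ
  point a = inj₁ (pts (a mod K))
  line  a = inj₂ (lns (a mod K))

  toℕ-mod : ∀ i → toℕ i mod K ≡ i
  toℕ-mod i = toℕ-injective (trans (toℕ-fromℕ< _) (m<n⇒m%n≡m (toℕ<n i)))

  +K-mod : ∀ a → (a + K) mod K ≡ a mod K
  +K-mod a = toℕ-injective (trans (toℕ-fromℕ< _) (trans ([m+n]%n≡m%n a K) (sym (toℕ-fromℕ< _))))

  next-mod : ∀ a → next (a mod K) ≡ suc a mod K
  next-mod a = toℕ-injective (trans (toℕ-fromℕ< _)
    (trans (cong (λ r → suc r % K) (toℕ-fromℕ< _)) (trans (suc[m%n]%n≡suc[m]%n a K) (sym (toℕ-fromℕ< _)))))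

  point~line : ∀ a → Adj (point a) (line a)
  point~line a = adjacent (inc₁ (a mod K))

  line~point : ∀ a → Adj (line a) (point (suc a))
  line~point a = adjacent (subst (λ i → Geometry.I Γ (pts i) (lns (a mod K)) ≡ true) (next-mod a) (inc₂ (a mod K)))

  walk-to-point : ∀ a n → Within (n + n) (point a) (point (a + n))
  walk-to-point a zero    rewrite +-identityʳ a = Within-refl (point a)
  walk-to-point a (suc n) = subst₂ (λ l b → Within l (point a) (point b)) (sym (+-suc (suc n) n)) (sym (+-suc a n))
    (Within-∷ʳ (Within-∷ʳ (walk-to-point a n) (point~line (a + n))) (line~point (a + n)))

  walk-to-line : ∀ a n → Within (suc (n + n)) (point a) (line (a + n))
  walk-to-line a n = Within-∷ʳ (walk-to-point a n) (point~line (a + n))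

  lift : ∀ (i j : Fin K) → ∃ λ j′ → toℕ i ≤ j′ × j′ < toℕ i + K × j′ mod K ≡ j
  lift i j with toℕ i ≤? toℕ j
  ... | yes i≤j = toℕ j , i≤j , ≤-trans (toℕ<n j) (m≤n+m K (toℕ i)) , toℕ-mod j
  ... | no  i≰j = toℕ j + K , ≤-trans (<⇒≤ (toℕ<n i)) (m≤n+m K (toℕ j)) ,
                  +-monoˡ-< K (≰⇒> i≰j) , trans (+K-mod (toℕ j)) (toℕ-mod j)

  walks-around : ∀ (i j : Fin K) → ∃ λ x → ∃ λ y → suc (x + y) ≡ K ×
                 Within (suc (x + x)) (inj₁ (pts i)) (inj₂ (lns j)) × Within (suc (y + y)) (inj₁ (pts i)) (inj₂ (lns j))
  walks-around i j with lift i j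
  ... | j′ , i≤j′ , j′<i+K , j′≡j = x , y , x+y+1≡K ,
        subst₂ (λ a b → Within (suc (x + x)) a b) (cong inj₁ (cong pts (toℕ-mod i)))
               (cong inj₂ (trans (cong (λ b → lns (b mod K)) i+x≡j′) (cong lns j′≡j)))
               (walk-to-line (toℕ i) x) ,
        Within-sym (subst₂ (λ a b → Within (suc (y + y)) a b) (cong inj₂ (cong lns j′≡j))
               (cong inj₁ (trans (cong (λ b → pts (b mod K)) 1+j′+y≡i+K) (trans (cong pts (+K-mod (toℕ i))) (cong pts (toℕ-mod i)))))
               (Within-∷ (line~point j′) (walk-to-point (suc j′) y)))
    where
    x y : ℕ
    x = j′ ∸ toℕ i
    y = (toℕ i + K) ∸ suc j′
    i+x≡j′ : toℕ i + x ≡ j′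
    i+x≡j′ = m+[n∸m]≡n i≤j′
    1+j′+y≡i+K : suc j′ + y ≡ toℕ i + K
    1+j′+y≡i+K = m+[n∸m]≡n j′<i+K
    x+y+1≡K : suc (x + y) ≡ K
    x+y+1≡K = +-cancelˡ-≡ (toℕ i) _ _ (begin
      toℕ i + suc (x + y)   ≡⟨ +-suc (toℕ i) (x + y) ⟩
      suc (toℕ i + (x + y)) ≡⟨ cong suc (+-assoc (toℕ i) x y) ⟨
      suc (toℕ i + x + y)   ≡⟨ cong (λ n → suc n + y) i+x≡j′ ⟩
      suc j′ + y            ≡⟨ 1+j′+y≡i+K ⟩
      toℕ i + K             ∎)
      where open ≡-Reasoning

module Projection (Γ : Geometry) where
  open Distance Γ
  open Geodesics Γ

  gon-point-line-Within : ∀ {m} → 1 ≤ m → (G : OrdinaryGon Γ (m + m)) → ∀ i j →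
    ∃ λ d → d < m + m × Within d (inj₁ (OrdinaryGon.pts G i)) (inj₂ (OrdinaryGon.lns G j))
  gon-point-line-Within {suc m} _ G i j with GonWalks.walks-around Γ G i j
  ... | x , y , x+y+1≡K , walk-x , walk-y with x <? suc m
  ...   | yes x<m = suc (x + x) , double-<-odd x<m , walk-x
  ...   | no  x≮m = suc (y + y) , double-<-odd y<m , walk-y
    where
    y<m : y < suc m
    y<m = +-cancelˡ-< (suc m) y (suc m)
            (≤-<-trans (+-monoˡ-≤ y (≮⇒≥ x≮m)) (subst (x + y <_) x+y+1≡K (n<1+n (x + y))))

  record ClosestPoint (m : ℕ) (v : Pt Γ) (L : Ln Γ) : Set where
    field
      x₀        : Pt Γ
      r         : ℕ
      x₀∈L      : Geometry.I Γ x₀ L ≡ true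
      r<m       : r < m
      v-x₀      : Dist (inj₁ v) (inj₁ x₀) (2 * r)
      v-others  : ∀ x → Geometry.I Γ x L ≡ true → x ≢ x₀ → Dist (inj₁ v) (inj₁ x) (2 * suc r)

  common-gon-Within : ∀ {m} → 1 ≤ m → WeakGenPolygon Γ (2 * m) → ∀ v L →
                      ∃ λ d → d < 2 * m × Within d (inj₁ v) (inj₂ L)
  common-gon-Within {m} 1≤m W v L = within-gon (2*n≡n+n m) (WeakGenPolygon.common-gon W (inj₁ v) (inj₂ L))
    where
    within-gon : ∀ {n} → n ≡ m + m → Σ (OrdinaryGon Γ n) (λ G → _∈Gon_ Γ (inj₁ v) G × _∈Gon_ Γ (inj₂ L) G) →
                 ∃ λ d → d < n × Within d (inj₁ v) (inj₂ L)
    within-gon refl (G , (i , refl) , (j , refl)) = gon-point-line-Within 1≤m G i j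

  closest-point : ∀ {m} → 1 ≤ m → WeakGenPolygon Γ (2 * m) → ∀ v L → ClosestPoint m v L
  closest-point {m} 1≤m W v L with common-gon-Within 1≤m W v L
  ... | F , F<2m , v~L with Within⇒Dist v~L
  ...   | zero , v-L , _ with () ← Dist-0⁻ v-L
  ...   | suc d , v-L , d<F with Dist-pred v-L
  ...     | inj₂ _ , adjacent () , _
  ...     | inj₁ x₀ , x₀~L , v-x₀ with alternate≡⇒even d true (sym (Dist-isPoint v-x₀))
  ...       | r , refl = record
    { x₀ = x₀ ; r = r ; x₀∈L = adj≡true x₀~L
    ; r<m = *-cancelˡ-< 2 r m (subst (_< 2 * m) (sym (2*n≡n+n r)) (<-trans (n<1+n _) d<2m))
    ; v-x₀ = subst (Dist (inj₁ v) (inj₁ x₀)) (sym (2*n≡n+n r)) v-x₀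
    ; v-others = v-others
    }
    where
    d<2m : suc (r + r) < 2 * m
    d<2m = ≤-<-trans d<F F<2m
    v-others : ∀ x → Geometry.I Γ x L ≡ true → x ≢ x₀ → Dist (inj₁ v) (inj₁ x) (2 * suc r)
    v-others x x∈L x≢x₀ with Within⇒Dist (Within-∷ʳ v~L (adjacent {inj₂ L} {inj₁ x} x∈L))
    ... | dx , v-x , _ with Adj⇒Dist-suc (adjacent {inj₂ L} {inj₁ x} x∈L) v-L v-x
    ... | inj₁ refl = subst (Dist (inj₁ v) (inj₁ x)) (sym (trans (2*n≡n+n (suc r)) (double-suc r))) v-x
    ... | inj₂ refl = ⊥-elim (no-fork (WeakGenPolygon.no-small-gons W) (r + r) d<2m
                        (fork (x≢x₀ ∘ sym ∘ inj₁-injective) x₀~L (adjacent x∈L) v-x₀ v-x v-L))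

module _ {c ℓ} (F : Field c ℓ) {Γ : Geometry} {m s t : ℕ} (1≤m : 1 ≤ m)
         (W : WeakGenPolygon Γ (2 * m)) (order : HasOrder Γ s t) where
  open Field F using (_≈_; 1#) renaming (trans to ≈-trans)
  open Lin F Γ using (𝔠; ⟨_,_⟩; 𝔦L)
  open LineSums F Γ using (coeff; coeff-telescopes; 𝔠-value; two-valued-line-sum)
  open Distance Γ using (Dist; mkDist; distEq≡true; Dist-unique)

  𝔠-at-distance : ∀ {v x} q → Dist (inj₁ v) (inj₁ x) (2 * q) → 𝔠 m s v x ≈ coeff m s q
  𝔠-at-distance q v-x = 𝔠-value m s (distEq≡true v-x)
    (λ k x∈P₂k → *-cancelˡ-≡ k q 2 (Dist-unique (mkDist x∈P₂k) v-x))

  𝔠-line-sum : ∀ v L → ⟨ 𝔠 m s v , 𝔦L L ⟩ ≈ 1#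
  𝔠-line-sum v L = ≈-trans
    (two-valued-line-sum (𝔠 m s v) x₀∈L (proj₁ order L) (𝔠-at-distance r v-x₀)
              (λ x x∈L x≢x₀ → 𝔠-at-distance (suc r) (v-others x x∈L x≢x₀)))
    (coeff-telescopes m s r<m)
    where open Projection.ClosestPoint (Projection.closest-point Γ 1≤m W v L)

lemma3p4 : ∀ {c ℓ} (F : Field c ℓ) (Γ : Geometry) (m s t : ℕ) → 2 ≤ m →
    WeakGenPolygon Γ (2 * m) → HasOrder Γ s t →
    ∀ (v w : Pt Γ) → Lin.InCD F Γ (λ x → Field._-_ F (Lin.𝔠 F Γ m s v x) (Lin.𝔠 F Γ m s w x))
lemma3p4 F Γ m s t 2≤m W order v w =
  LineSums.equal-line-sums⇒InCD F Γ (Lin.𝔠 F Γ m s v) (Lin.𝔠 F Γ m s w)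
    (λ L → Field.trans F (𝔠-line-sum F 1≤m W order v L) (Field.sym F (𝔠-line-sum F 1≤m W order w L)))
  where
  1≤m : 1 ≤ m
  1≤m = ≤-trans (s≤s z≤n) 2≤m
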